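{- For any Dyck path $d$ of semilength $n$, we have $m_d = 2n - 1 - \mathrm{bpk}(d)$, where $m_d=\deg C_d(t)$ and $\mathrm{bpk}(d)$ is the number of peaks of the bounce path of $d$.
   Context: A Dyck path of semilength $n$ is a lattice path from $(0,0)$ to $(2n,0)$ with steps $U=(1,1)$ and $D=(1,-1)$ never going below the $x$-axis. A peak is an occurrence of $UD$. The bounce path of $d$ is constructed as follows: start at $(0,0)$ and take up-steps until reaching a point of $d$ at which $d$'s next step is a down-step; then take down-steps until reaching the $x$-axis; then again take up-steps until encountering a down-step of $d$, and repeat until $(2n,0)$ is reached. $\mathrm{bpk}(d)$ is the number of peaks of the bounce path. For $\sigma=\sigma_1\cdots\sigma_n\in\mathfrak{S}_n$, $\mathrm{can}(d,\sigma)$ is the word of length $2n$ obtained by labeling the $i$-th up-step and the $i$-th down-step of $d$ with $\sigma_i$ and reading labels left to right. $\mathrm{des}(d,\sigma)$ is the number of indices $j\in[2n-1]$ with $\mathrm{can}(d,\sigma)_j>\mathrm{can}(d,\sigma)_{j+1}$. $C_d(t)=\sum_{\sigma\in\mathfrak{S}_n} t^{\mathrm{des}(d,\sigma)}$ and $m_d=\deg C_d(t)$. -}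

module Defs where

open import Data.Bool using (Bool; true; false; if_then_else_; _∧_; T)
open import Data.Nat using (ℕ; zero; suc; _+_; _*_; _∸_; _≤_; _<_; _<ᵇ_; _≡ᵇ_)
open import Data.Nat.Properties using (_<?_)
open import Data.List using (List; []; _∷_; length; _++_; replicate; take)
open import Data.Maybe using (Maybe; just; nothing)
open import Data.Fin using (Fin; toℕ; fromℕ<)
open import Data.Fin.Permutation using (Permutation′; _⟨$⟩ʳ_)
open import Data.Product using (Σ; _×_)
open import Relation.Nullary using (yes; no)
open import Relation.Binary.PropositionalEquality using (_≡_)

-- Lattice paths are words in {U, D}: true = U = (1,1), false = D = (1,-1).

dyckFrom : ℕ → List Bool → Bool
dyckFrom zero    []            = true
dyckFrom (suc _) []            = false
dyckFrom h       (true ∷ w)    = dyckFrom (suc h) w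
dyckFrom zero    (false ∷ w)   = false
dyckFrom (suc h) (false ∷ w)   = dyckFrom h w

IsDyck : ℕ → List Bool → Set
IsDyck n d = (length d ≡ 2 * n) × T (dyckFrom 0 d)

ups : List Bool → ℕ
ups []           = 0
ups (true ∷ w)   = suc (ups w)
ups (false ∷ w)  = ups w

downs : List Bool → ℕ
downs []          = 0
downs (true ∷ w)  = downs w
downs (false ∷ w) = suc (downs w)

height : List Bool → ℕ → ℕ
height d j = ups (take j d) ∸ downs (take j d)

stepAt : List Bool → ℕ → Maybe Bool
stepAt []      _       = nothing
stepAt (s ∷ _) zero    = just s
stepAt (_ ∷ w) (suc t) = stepAt w t

isDown : Maybe Bool → Bool
isDown (just false) = true
isDown _            = false

-- Starting from (x,0) and going up, the bounce path is at (t, t - x).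
-- findTop searches the first t ≥ x such that (t, t - x) is a point of d
-- and d's next step is a down step (fuel bounds the search).
findTop : ℕ → List Bool → ℕ → ℕ → Maybe ℕ
findTop zero     d x t = nothing
findTop (suc f)  d x t =
  if ((height d t + x) ≡ᵇ t) ∧ isDown (stepAt d t)
  then just t
  else findTop f d x (suc t)

bounceFrom : ℕ → List Bool → ℕ → List Bool
bounceFrom zero    d x = []
bounceFrom (suc f) d x with x <ᵇ length d
... | false = []
... | true with findTop (suc (length d)) d x x
...   | nothing = []
...   | just t  = replicate (t ∸ x) true ++ replicate (t ∸ x) false
                    ++ bounceFrom f d (t + (t ∸ x))

bounce : List Bool → List Bool
bounce d = bounceFrom (length d) d 0

peaks : List Bool → ℕ
peaks []                   = 0
peaks (true ∷ false ∷ w)   = suc (peaks w)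
peaks (_ ∷ w)              = peaks w

bpk : List Bool → ℕ
bpk d = peaks (bounce d)

-- σ_i for a 0-based index i (values in {0,..,n-1}; shifting all labels by 1
-- does not affect descents). Out-of-range indices never occur for Dyck paths.
label : {n : ℕ} → Permutation′ n → ℕ → ℕ
label {n} σ i with i <? n
... | yes p = toℕ (σ ⟨$⟩ʳ fromℕ< p)
... | no _  = 0

-- can(d,σ): the i-th up step and the i-th down step both get σ_i;
-- u, v count the up / down steps read so far.
canFrom : {n : ℕ} → Permutation′ n → ℕ → ℕ → List Bool → List ℕ
canFrom σ u v []          = []
canFrom σ u v (true ∷ w)  = label σ u ∷ canFrom σ (suc u) v w
canFrom σ u v (false ∷ w) = label σ v ∷ canFrom σ u (suc v) w

can : {n : ℕ} → List Bool → Permutation′ n → List ℕ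
can d σ = canFrom σ 0 0 d

descents : List ℕ → ℕ
descents []            = 0
descents (a ∷ [])      = 0
descents (a ∷ b ∷ w)   = (if b <ᵇ a then 1 else 0) + descents (b ∷ w)

des : {n : ℕ} → List Bool → Permutation′ n → ℕ
des d σ = descents (can d σ)

-- C_d(t) = Σ_σ t^{des(d,σ)} has nonnegative coefficients; its coefficient of
-- t^j is nonzero iff some σ has des(d,σ) = j. Hence m_d = deg C_d(t) = k iff
-- k is attained by des(d,·) and bounds all its values.
DegC≡ : (n : ℕ) → List Bool → ℕ → Set
DegC≡ n d k = Σ (Permutation′ n) (λ σ → des d σ ≡ k)
            × ((σ : Permutation′ n) → des d σ ≤ k)

-- Read can(d, σ) through the word of indices of d, in which the i-th up step
-- and the i-th down step both carry i, and count weak ascents instead of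
-- descents: des(d, σ) = 2n - 1 - (number of weak ascents).  If the first
-- bounce of d has height 1 + h, deleting the first 1 + h up steps and the
-- first 1 + h down steps of d leaves a Dyck path d′ with bpk d = 1 + bpk d′.
-- In the index word of d the run s, s+1, ..., s+h is followed by s again, so
-- every labelling has a weak ascent there, and the rest of the word contains
-- the index word of d′ as a subsequence, which has no more weak ascents; hence
-- every labelling has at least bpk d weak ascents.  Conversely, the labels of
-- an optimal labelling of d′ leave room to slot in the labels of the first
-- bounce so that d is read strictly decreasingly from its first down step to
-- the first down step of d′; then d has at most one weak ascent more than d′.
-- Ranking the labels turns them into a permutation.

module Submission where

open import Data.Bool using (Bool; true; false; if_then_else_; T; _∧_)
open import Data.Bool.Properties using (T-∧; T-≡)
open import Data.Empty using (⊥-elim)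
open import Data.Fin as Fin using (Fin; toℕ; fromℕ<; punchOut)
open import Data.Fin.Permutation using (Permutation′; permutation)
open import Data.Fin.Properties
  using (toℕ-injective; toℕ<n; toℕ-fromℕ<; punchOut-injective; any?; injective⇒≤)
open import Data.List using (List; []; _∷_; _++_; length; map; replicate; take)
open import Data.List.Properties using (length-++; length-replicate; length-map; map-++; ++-identityʳ)
open import Data.List.Relation.Binary.Sublist.Propositional using (_⊆_; []; _∷_; _∷ʳ_; ⊆-refl)
open import Data.List.Relation.Binary.Sublist.Propositional.Properties using (map⁺; ++⁺)
open import Data.List.Relation.Unary.All using (All; []; _∷_)
open import Data.List.Relation.Unary.Linked as Linked using (Linked; []; [-]; _∷_)
open import Data.Maybe using (just)
open import Data.Nat using (ℕ; zero; suc; _+_; _*_; _∸_; _≤_; _<_; _>_; z≤n; s≤s; _<ᵇ_; _≡ᵇ_)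
open import Data.Nat.Induction using (<-wellFounded)
open import Data.Nat.Properties
open import Data.Product using (_,_; proj₁; proj₂; _×_; ∃; ∃₂)
open import Data.Sum using (inj₁; inj₂)
open import Data.Unit using (tt)
open import Function using (_∘_)
open import Function.Bundles using (Equivalence)
open import Function.Definitions using (Injective)
open import Induction.WellFounded using (Acc; acc)
open import Relation.Binary.Definitions using (tri<; tri≈; tri>)
open import Relation.Binary.PropositionalEquality
open import Relation.Nullary using (yes; no)
open import Relation.Nullary.Reflects using (ofʸ; ofⁿ)

open import Defs

if-<ᵇ-< : ∀ {A : Set} {m n} {x y : A} → m < n → (if m <ᵇ n then x else y) ≡ x
if-<ᵇ-< {m = m} {n} m<n rewrite Equivalence.to T-≡ (<⇒<ᵇ m<n) = refl

if-<ᵇ-≥ : ∀ {A : Set} {m n} {x y : A} → n ≤ m → (if m <ᵇ n then x else y) ≡ y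
if-<ᵇ-≥ {m = m} {n} n≤m with m <ᵇ n | <ᵇ-reflects-< m n
... | true  | ofʸ m<n = ⊥-elim (<⇒≱ m<n n≤m)
... | false | _       = refl

weakAscent : ℕ → ℕ → ℕ
weakAscent a b = if b <ᵇ a then 0 else 1

weakAscent≤1 : ∀ a b → weakAscent a b ≤ 1
weakAscent≤1 a b with b <ᵇ a
... | true  = z≤n
... | false = ≤-refl

weakAscentsFrom : ℕ → List ℕ → ℕ
weakAscentsFrom a []      = 0
weakAscentsFrom a (b ∷ w) = weakAscent a b + weakAscentsFrom b w

weakAscents : List ℕ → ℕ
weakAscents []      = 0
weakAscents (a ∷ w) = weakAscentsFrom a w

descents+weakAscentsFrom : ∀ a w → descents (a ∷ w) + weakAscentsFrom a w ≡ length w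
descents+weakAscentsFrom a []      = refl
descents+weakAscentsFrom a (b ∷ w) with b <ᵇ a
... | true  = cong suc (descents+weakAscentsFrom b w)
... | false = trans (+-suc (descents (b ∷ w)) _) (cong suc (descents+weakAscentsFrom b w))

descents≡length∸1∸weakAscents : ∀ w → descents w ≡ length w ∸ 1 ∸ weakAscents w
descents≡length∸1∸weakAscents []      = refl
descents≡length∸1∸weakAscents (a ∷ w) =
  sym (trans (cong (_∸ weakAscentsFrom a w) (sym (descents+weakAscentsFrom a w)))
             (m+n∸n≡m (descents (a ∷ w)) (weakAscentsFrom a w)))

weakAscents≤weakAscentsFrom : ∀ a w → weakAscents w ≤ weakAscentsFrom a w
weakAscents≤weakAscentsFrom a []      = z≤n
weakAscents≤weakAscentsFrom a (b ∷ w) = m≤n+m _ _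

-- If a > c then a > b or b > c: deleting b cannot create a weak ascent.
weakAscentsFrom-delete : ∀ a b w → weakAscentsFrom a w ≤ weakAscentsFrom a (b ∷ w)
weakAscentsFrom-delete a b []      = z≤n
weakAscentsFrom-delete a b (c ∷ w) with c <ᵇ a | <ᵇ-reflects-< c a
... | true  | _ = ≤-trans (m≤n+m _ (weakAscent b c)) (m≤n+m _ (weakAscent a b))
... | false | ofⁿ c≮a with b <ᵇ a | <ᵇ-reflects-< b a
...   | false | _       = s≤s (m≤n+m _ _)
...   | true  | ofʸ b<a = ≤-reflexive (cong (_+ weakAscentsFrom c w)
                            (sym (if-<ᵇ-≥ (≤-trans (<⇒≤ b<a) (≮⇒≥ c≮a)))))

weakAscentsFrom-mono-⊆ : ∀ a {xs ys} → xs ⊆ ys → weakAscentsFrom a xs ≤ weakAscentsFrom a ys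
weakAscentsFrom-mono-⊆ a []                = ≤-refl
weakAscentsFrom-mono-⊆ a (_∷ʳ_ {ys = ys} y p) =
  ≤-trans (weakAscentsFrom-mono-⊆ a p) (weakAscentsFrom-delete a y ys)
weakAscentsFrom-mono-⊆ a (_∷_ {x = x} refl p) =
  +-monoʳ-≤ (weakAscent a x) (weakAscentsFrom-mono-⊆ x p)

weakAscentsFrom-suffix : ∀ a xs b ys → weakAscentsFrom b ys ≤ weakAscentsFrom a (xs ++ b ∷ ys)
weakAscentsFrom-suffix a []       b ys = m≤n+m _ _
weakAscentsFrom-suffix a (x ∷ xs) b ys = ≤-trans (weakAscentsFrom-suffix x xs b ys) (m≤n+m _ _)

weakAscentsFrom-return : ∀ {a b} xs ys → a ≤ b →
                         suc (weakAscentsFrom b ys) ≤ weakAscentsFrom a (xs ++ b ∷ ys)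
weakAscentsFrom-return {a} {b} [] ys a≤b =
  ≤-reflexive (cong (_+ weakAscentsFrom b ys) (sym (if-<ᵇ-≥ a≤b)))
weakAscentsFrom-return {a} (x ∷ xs) ys a≤b with x <ᵇ a | <ᵇ-reflects-< x a
... | true  | ofʸ x<a = weakAscentsFrom-return xs ys (≤-trans (<⇒≤ x<a) a≤b)
... | false | _       = s≤s (weakAscentsFrom-suffix x xs _ ys)

weakAscentsFrom-descending : ∀ {a xs} → Linked _>_ (a ∷ xs) → weakAscentsFrom a xs ≡ 0
weakAscentsFrom-descending [-]          = refl
weakAscentsFrom-descending (b<a ∷ desc) rewrite if-<ᵇ-< {x = 0} {1} b<a =
  weakAscentsFrom-descending desc

weakAscentsFrom-descending-++ : ∀ {a xs} ys → Linked _>_ (a ∷ xs) →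
                                weakAscentsFrom a (xs ++ ys) ≤ suc (weakAscents ys)
weakAscentsFrom-descending-++     []       [-]          = z≤n
weakAscentsFrom-descending-++ {a} (y ∷ ys) [-]          = +-monoˡ-≤ _ (weakAscent≤1 a y)
weakAscentsFrom-descending-++     ys       (b<a ∷ desc) rewrite if-<ᵇ-< {x = 0} {1} b<a =
  weakAscentsFrom-descending-++ ys desc

linked-⊆ : ∀ {A : Set} {R : A → A → Set} → (∀ {x y z} → R x y → R y z → R x z) →
           ∀ {x xs ys} → xs ⊆ ys → Linked R (x ∷ ys) → Linked R (x ∷ xs)
linked-⊆ R-trans []           [-]         = [-]
linked-⊆ R-trans (y ∷ʳ sub)   lnk         = linked-⊆ R-trans sub (skip lnk)
  where
  skip : ∀ {x y zs} → Linked _ (x ∷ y ∷ zs) → Linked _ (x ∷ zs)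
  skip (_   ∷ [-])       = [-]
  skip (Rxy ∷ Ryz ∷ lnk) = R-trans Rxy Ryz ∷ lnk
linked-⊆ R-trans (refl ∷ sub) (Rxy ∷ lnk) = Rxy ∷ linked-⊆ R-trans sub lnk

weakAscents-map-≤ : ∀ {P : ℕ → Set} (f g : ℕ → ℕ) →
                    (∀ {x y} → P x → P y → f y < f x → g y < g x) →
                    ∀ {xs} → All P xs → weakAscents (map g xs) ≤ weakAscents (map f xs)
weakAscents-map-≤ {P} f g keeps []         = z≤n
weakAscents-map-≤ {P} f g keeps (px ∷ pxs) = from px pxs
  where
  from : ∀ {x xs} → P x → All P xs →
         weakAscentsFrom (g x) (map g xs) ≤ weakAscentsFrom (f x) (map f xs)
  from     px []                         = z≤n
  from {x} px (_∷_ {y} py pys) with f y <ᵇ f x | <ᵇ-reflects-< (f y) (f x)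
  ... | true  | ofʸ fy<fx rewrite if-<ᵇ-< {x = 0} {1} (keeps px py fy<fx) = from py pys
  ... | false | _ = +-mono-≤ (weakAscent≤1 (g x) (g y)) (from py pys)

range : ℕ → ℕ → List ℕ
range u zero    = []
range u (suc k) = u ∷ range (suc u) k

DescendingOn : (ℕ → ℕ) → ℕ → ℕ → Set
DescendingOn g a k = Linked _>_ (map g (range a k))

descendingOn⇒step : ∀ (g : ℕ → ℕ) {a k} → DescendingOn g a k →
                     ∀ {u} → a ≤ u → suc u < a + k → g (suc u) < g u
descendingOn⇒step g {a} {k} lnk {u} a≤u su< with m≤n⇒m<n∨m≡n a≤u | k | lnk
... | inj₂ refl | suc (suc k) | lt ∷ _ = lt
... | inj₂ refl | suc zero    | _      = ⊥-elim (<-irrefl refl (subst (suc a <_) (+-comm a 1) su<))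
... | inj₁ a<u  | suc k       | lnk′   =
  descendingOn⇒step g (Linked.tail lnk′) a<u (subst (suc u <_) (+-suc a k) su<)
... | _         | zero        | _      =
  ⊥-elim (<⇒≱ su< (≤-trans (≤-reflexive (+-identityʳ a)) (m≤n⇒m≤1+n a≤u)))

weakAscents-range-return : ∀ (g : ℕ → ℕ) u m R → 0 < m →
  suc (weakAscentsFrom (g u) (map g R)) ≤ weakAscents (map g (range u m ++ u ∷ R))
weakAscents-range-return g u (suc m) R _ =
  subst (suc (weakAscentsFrom (g u) (map g R)) ≤_)
        (cong (weakAscentsFrom (g u)) (sym (map-++ g (range (suc u) m) (u ∷ R))))
        (weakAscentsFrom-return (map g (range (suc u) m)) (map g R) ≤-refl)

indexWord : ℕ → ℕ → List Bool → List ℕ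
indexWord u v []          = []
indexWord u v (true ∷ w)  = u ∷ indexWord (suc u) v w
indexWord u v (false ∷ w) = v ∷ indexWord u (suc v) w

canFrom≡map-label : ∀ {n} (σ : Permutation′ n) u v w →
                    canFrom σ u v w ≡ map (label σ) (indexWord u v w)
canFrom≡map-label σ u v []          = refl
canFrom≡map-label σ u v (true ∷ w)  = cong (label σ u ∷_) (canFrom≡map-label σ (suc u) v w)
canFrom≡map-label σ u v (false ∷ w) = cong (label σ v ∷_) (canFrom≡map-label σ u (suc v) w)

length-indexWord : ∀ u v w → length (indexWord u v w) ≡ length w
length-indexWord u v []          = refl
length-indexWord u v (true ∷ w)  = cong suc (length-indexWord (suc u) v w)
length-indexWord u v (false ∷ w) = cong suc (length-indexWord u (suc v) w)

indexWord-++ : ∀ u v xs ys →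
               indexWord u v (xs ++ ys) ≡ indexWord u v xs ++ indexWord (u + ups xs) (v + downs xs) ys
indexWord-++ u v [] ys = cong₂ (λ a b → indexWord a b ys) (sym (+-identityʳ u)) (sym (+-identityʳ v))
indexWord-++ u v (true ∷ xs) ys = cong (u ∷_) (trans (indexWord-++ (suc u) v xs ys)
  (cong (λ a → indexWord (suc u) v xs ++ indexWord a (v + downs xs) ys) (sym (+-suc u (ups xs)))))
indexWord-++ u v (false ∷ xs) ys = cong (v ∷_) (trans (indexWord-++ u (suc v) xs ys)
  (cong (λ b → indexWord u (suc v) xs ++ indexWord (u + ups xs) b ys) (sym (+-suc v (downs xs)))))

indexWord-replicate : ∀ u v k ys →
                      indexWord u v (replicate k true ++ ys) ≡ range u k ++ indexWord (u + k) v ys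
indexWord-replicate u v zero    ys = cong (λ a → indexWord a v ys) (sym (+-identityʳ u))
indexWord-replicate u v (suc k) ys =
  cong (u ∷_) (trans (indexWord-replicate (suc u) v k ys)
                     (cong (λ a → range (suc u) k ++ indexWord a v ys) (sym (+-suc u k))))

upIndices⊆indexWord : ∀ u v w → range u (ups w) ⊆ indexWord u v w
upIndices⊆indexWord u v []          = []
upIndices⊆indexWord u v (true ∷ w)  = refl ∷ upIndices⊆indexWord (suc u) v w
upIndices⊆indexWord u v (false ∷ w) = v ∷ʳ upIndices⊆indexWord u (suc v) w

downIndices⊆indexWord : ∀ u v w → range v (downs w) ⊆ indexWord u v w
downIndices⊆indexWord u v []          = []
downIndices⊆indexWord u v (true ∷ w)  = u ∷ʳ downIndices⊆indexWord (suc u) v w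
downIndices⊆indexWord u v (false ∷ w) = refl ∷ downIndices⊆indexWord u (suc v) w

indexWord-≥ : ∀ {b u v} w → b ≤ u → b ≤ v → All (b ≤_) (indexWord u v w)
indexWord-≥ []          b≤u b≤v = []
indexWord-≥ (true ∷ w)  b≤u b≤v = b≤u ∷ indexWord-≥ w (m≤n⇒m≤1+n b≤u) b≤v
indexWord-≥ (false ∷ w) b≤u b≤v = b≤v ∷ indexWord-≥ w b≤u (m≤n⇒m≤1+n b≤v)

indexWord-< : ∀ {b u v} w → u + ups w ≤ b → v + downs w ≤ b → All (_< b) (indexWord u v w)
indexWord-< []          _ _ = []
indexWord-< {u = u} (true ∷ w) ub vb rewrite +-suc u (ups w) =
  ≤-trans (s≤s (m≤m+n u (ups w))) ub ∷ indexWord-< w ub vb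
indexWord-< {v = v} (false ∷ w) ub vb rewrite +-suc v (downs w) =
  ≤-trans (s≤s (m≤m+n v (downs w))) vb ∷ indexWord-< w ub vb

Dyck : List Bool → Set
Dyck d = T (dyckFrom 0 d)

dyckFrom-true : ∀ h w → dyckFrom h (true ∷ w) ≡ dyckFrom (suc h) w
dyckFrom-true zero    w = refl
dyckFrom-true (suc h) w = refl

dyckFrom-replicate : ∀ k h w → dyckFrom h (replicate k true ++ w) ≡ dyckFrom (k + h) w
dyckFrom-replicate zero    h w = refl
dyckFrom-replicate (suc k) h w =
  trans (dyckFrom-true h _)
        (trans (dyckFrom-replicate k (suc h) w) (cong (λ m → dyckFrom m w) (+-suc k h)))

dyckFrom-balanced : ∀ h w → T (dyckFrom h w) → h + ups w ≡ downs w
dyckFrom-balanced zero    []          _  = refl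
dyckFrom-balanced h       (true ∷ w)  dy =
  trans (+-suc h (ups w)) (dyckFrom-balanced (suc h) w (subst T (dyckFrom-true h w) dy))
dyckFrom-balanced (suc h) (false ∷ w) dy = cong suc (dyckFrom-balanced h w dy)

dyckFrom-prefix : ∀ h w t → T (dyckFrom h w) → downs (take t w) ≤ h + ups (take t w)
dyckFrom-prefix h       w           zero    _  = z≤n
dyckFrom-prefix h       []          (suc t) _  = z≤n
dyckFrom-prefix h       (true ∷ w)  (suc t) dy rewrite +-suc h (ups (take t w)) =
  dyckFrom-prefix (suc h) w t (subst T (dyckFrom-true h w) dy)
dyckFrom-prefix (suc h) (false ∷ w) (suc t) dy = s≤s (dyckFrom-prefix h w t dy)

dyckFrom-++ : ∀ h xs ys → T (dyckFrom h (xs ++ ys)) → T (dyckFrom (h + ups xs ∸ downs xs) ys)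
dyckFrom-++ h []           ys dy = subst (λ m → T (dyckFrom m ys)) (sym (+-identityʳ h)) dy
dyckFrom-++ h (true ∷ xs)  ys dy =
  subst (λ m → T (dyckFrom (m ∸ downs xs) ys)) (sym (+-suc h (ups xs)))
        (dyckFrom-++ (suc h) xs ys (subst T (dyckFrom-true h (xs ++ ys)) dy))
dyckFrom-++ (suc h) (false ∷ xs) ys dy = dyckFrom-++ h xs ys dy

dyck-ups≡downs : ∀ d → Dyck d → ups d ≡ downs d
dyck-ups≡downs d = dyckFrom-balanced 0 d

length≡ups+downs : ∀ w → length w ≡ ups w + downs w
length≡ups+downs []          = refl
length≡ups+downs (true ∷ w)  = cong suc (length≡ups+downs w)
length≡ups+downs (false ∷ w) = trans (cong suc (length≡ups+downs w)) (sym (+-suc (ups w) (downs w)))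

ups≤length : ∀ w → ups w ≤ length w
ups≤length w = subst (ups w ≤_) (sym (length≡ups+downs w)) (m≤m+n (ups w) (downs w))

ups-++ : ∀ xs ys → ups (xs ++ ys) ≡ ups xs + ups ys
ups-++ []           ys = refl
ups-++ (true ∷ xs)  ys = cong suc (ups-++ xs ys)
ups-++ (false ∷ xs) ys = ups-++ xs ys

ups-replicate : ∀ k w → ups (replicate k true ++ w) ≡ k + ups w
ups-replicate zero    w = refl
ups-replicate (suc k) w = cong suc (ups-replicate k w)

double-injective : ∀ {m n} → m + m ≡ n + n → m ≡ n
double-injective {m} {n} eq with <-cmp m n
... | tri< m<n _ _ = ⊥-elim (<-irrefl eq (+-mono-< m<n m<n))
... | tri≈ _ m≡n _ = m≡n
... | tri> _ _ n<m = ⊥-elim (<-irrefl (sym eq) (+-mono-< n<m n<m))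

upsBefore : List Bool → ℕ → ℕ
upsBefore []          c       = 0
upsBefore (true ∷ w)  c       = suc (upsBefore w c)
upsBefore (false ∷ w) zero    = 0
upsBefore (false ∷ w) (suc c) = upsBefore w c

upsBefore-++ : ∀ xs ys c → upsBefore (xs ++ ys) (downs xs + c) ≡ ups xs + upsBefore ys c
upsBefore-++ []           ys c = refl
upsBefore-++ (true ∷ xs)  ys c = cong suc (upsBefore-++ xs ys c)
upsBefore-++ (false ∷ xs) ys c = upsBefore-++ xs ys c

upsBefore-replicate : ∀ k w c → upsBefore (replicate k true ++ w) c ≡ k + upsBefore w c
upsBefore-replicate zero    w c = refl
upsBefore-replicate (suc k) w c = cong suc (upsBefore-replicate k w c)

upsBefore≤ups : ∀ w c → upsBefore w c ≤ ups w
upsBefore≤ups []          c       = z≤n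
upsBefore≤ups (true ∷ w)  c       = s≤s (upsBefore≤ups w c)
upsBefore≤ups (false ∷ w) zero    = z≤n
upsBefore≤ups (false ∷ w) (suc c) = upsBefore≤ups w c

dyckFrom-upsBefore : ∀ h w c → T (dyckFrom h w) → c < downs w → c < h + upsBefore w c
dyckFrom-upsBefore h       (true ∷ w)  c       dy c< rewrite +-suc h (upsBefore w c) =
  dyckFrom-upsBefore (suc h) w c (subst T (dyckFrom-true h w) dy) c<
dyckFrom-upsBefore (suc h) (false ∷ w) zero    dy c< = s≤s z≤n
dyckFrom-upsBefore (suc h) (false ∷ w) (suc c) dy c< = s≤s (dyckFrom-upsBefore h w c dy (≤-pred c<))

stepAt-upsBefore : ∀ w c → c < downs w → stepAt w (upsBefore w c + c) ≡ just false
stepAt-upsBefore (true ∷ w)  c       c< = stepAt-upsBefore w c c<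
stepAt-upsBefore (false ∷ w) zero    c< = refl
stepAt-upsBefore (false ∷ w) (suc c) c< rewrite +-suc (upsBefore w c) c = stepAt-upsBefore w c (≤-pred c<)

ups-take-upsBefore : ∀ w c → ups (take (upsBefore w c + c) w) ≡ upsBefore w c
ups-take-upsBefore []          zero    = refl
ups-take-upsBefore []          (suc c) = refl
ups-take-upsBefore (true ∷ w)  c       = cong suc (ups-take-upsBefore w c)
ups-take-upsBefore (false ∷ w) zero    = refl
ups-take-upsBefore (false ∷ w) (suc c) rewrite +-suc (upsBefore w c) c = ups-take-upsBefore w c

downs-take-upsBefore : ∀ w c → c ≤ downs w → downs (take (upsBefore w c + c) w) ≡ c
downs-take-upsBefore []          zero    _  = refl
downs-take-upsBefore (true ∷ w)  c       c≤ = downs-take-upsBefore w c c≤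
downs-take-upsBefore (false ∷ w) zero    _  = refl
downs-take-upsBefore (false ∷ w) (suc c) c≤ rewrite +-suc (upsBefore w c) c =
  cong suc (downs-take-upsBefore w c (≤-pred c≤))

stepAt-false⇒upsBefore : ∀ w t → stepAt w t ≡ just false →
                         t ≡ upsBefore w (downs (take t w)) + downs (take t w)
stepAt-false⇒upsBefore (false ∷ w) zero    _  = refl
stepAt-false⇒upsBefore (true ∷ w)  (suc t) eq = cong suc (stepAt-false⇒upsBefore w t eq)
stepAt-false⇒upsBefore (false ∷ w) (suc t) eq =
  trans (cong suc (stepAt-false⇒upsBefore w t eq)) (sym (+-suc _ (downs (take t w))))

stepAt-just⇒length-take : ∀ {b} w t → stepAt w t ≡ just b → ups (take t w) + downs (take t w) ≡ t
stepAt-just⇒length-take (_ ∷ w)     zero    _  = refl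
stepAt-just⇒length-take (true ∷ w)  (suc t) eq = cong suc (stepAt-just⇒length-take w t eq)
stepAt-just⇒length-take (false ∷ w) (suc t) eq =
  trans (+-suc (ups (take t w)) _) (cong suc (stepAt-just⇒length-take w t eq))

stepAt-just⇒< : ∀ {b} w t → stepAt w t ≡ just b → t < length w
stepAt-just⇒< (_ ∷ w) zero    _  = s≤s z≤n
stepAt-just⇒< (_ ∷ w) (suc t) eq = s≤s (stepAt-just⇒< w t eq)

isTop : List Bool → ℕ → ℕ → Bool
isTop d x t = ((height d t + x) ≡ᵇ t) ∧ isDown (stepAt d t)

findTop-just : ∀ {d x top} → (∀ t → T (isTop d x t) → t ≡ top) → T (isTop d x top) →
               ∀ f t → t ≤ top → top < t + f → findTop f d x t ≡ just top
findTop-just unique atTop zero    t t≤ <t+0 =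
  ⊥-elim (<⇒≱ <t+0 (subst (_≤ _) (sym (+-identityʳ t)) t≤))
findTop-just {d} {x} {top} unique atTop (suc f) t t≤ <t+f with isTop d x t in eq
... | true  = cong just (unique t (subst T (sym eq) tt))
... | false = findTop-just unique atTop f (suc t) (≤∧≢⇒< t≤ t≢top) (subst (top <_) (+-suc t f) <t+f)
  where
  t≢top : t ≢ top
  t≢top refl = subst T eq atTop

isDown⇒false : ∀ m → T (isDown m) → m ≡ just false
isDown⇒false (just false) _ = refl

<ᵇ-irrefl : ∀ n → (n <ᵇ n) ≡ false
<ᵇ-irrefl zero    = refl
<ᵇ-irrefl (suc n) = <ᵇ-irrefl n

tent : ℕ → List Bool → List Bool
tent k X = replicate k true ++ replicate k false ++ X

peaks-tent : ∀ k X → peaks (tent (suc k) X) ≡ suc (peaks X)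
peaks-tent k X = trans (ascent k (replicate k false ++ X)) (cong suc (descent k))
  where
  ascent : ∀ k Z → peaks (replicate (suc k) true ++ false ∷ Z) ≡ peaks (true ∷ false ∷ Z)
  ascent zero    Z = refl
  ascent (suc k) Z = ascent k Z
  descent : ∀ k → peaks (replicate k false ++ X) ≡ peaks X
  descent zero    = refl
  descent (suc k) = descent k

-- From (c + c, 0) the bounce path of d climbs to the top of the c-th down step
-- of d, and with a = upsBefore d c it comes back down at (a + a, 0).
module Bounce (d : List Bool) (dy : Dyck d) where

  length≡ups+ups : length d ≡ ups d + ups d
  length≡ups+ups = trans (length≡ups+downs d) (cong (ups d +_) (sym (dyck-ups≡downs d dy)))

  isTop-upsBefore : ∀ c → c < downs d → T (isTop d (c + c) (upsBefore d c + c))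
  isTop-upsBefore c c< =
    Equivalence.from T-∧ (≡⇒≡ᵇ _ _ reachesTop , subst (T ∘ isDown) (sym stepDown) tt)
    where
    a : ℕ
    a = upsBefore d c
    stepDown : stepAt d (a + c) ≡ just false
    stepDown = stepAt-upsBefore d c c<
    c≤a : c ≤ a
    c≤a = <⇒≤ (dyckFrom-upsBefore 0 d c dy c<)
    reachesTop : height d (a + c) + (c + c) ≡ a + c
    reachesTop = begin
      ups (take (a + c) d) ∸ downs (take (a + c) d) + (c + c)
        ≡⟨ cong₂ (λ u v → u ∸ v + (c + c))
                 (ups-take-upsBefore d c) (downs-take-upsBefore d c (<⇒≤ c<)) ⟩
      a ∸ c + (c + c)   ≡⟨ sym (+-assoc (a ∸ c) c c) ⟩
      a ∸ c + c + c     ≡⟨ cong (_+ c) (m∸n+n≡m c≤a) ⟩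
      a + c             ∎
      where open ≡-Reasoning

  isTop-unique : ∀ c t → T (isTop d (c + c) t) → t ≡ upsBefore d c + c
  isTop-unique c t top =
    subst (λ x → t ≡ upsBefore d x + x) (sym c≡D) (stepAt-false⇒upsBefore d t stepDown)
    where
    U D : ℕ
    U = ups (take t d)
    D = downs (take t d)
    stepDown : stepAt d t ≡ just false
    stepDown = isDown⇒false (stepAt d t) (proj₂ (Equivalence.to T-∧ top))
    onTop : U ∸ D + (c + c) ≡ t
    onTop = ≡ᵇ⇒≡ _ _ (proj₁ (Equivalence.to T-∧ top))
    c≡D : c ≡ D
    c≡D = double-injective (+-cancelˡ-≡ (U ∸ D) _ _ (begin
      U ∸ D + (c + c)   ≡⟨ onTop ⟩
      t                 ≡⟨ sym (stepAt-just⇒length-take d t stepDown) ⟩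
      U + D             ≡⟨ cong (_+ D) (sym (m∸n+n≡m (dyckFrom-prefix 0 d t dy))) ⟩
      U ∸ D + D + D     ≡⟨ +-assoc (U ∸ D) D D ⟩
      U ∸ D + (D + D)   ∎))
      where open ≡-Reasoning

  findTop-upsBefore : ∀ c → c < downs d →
                      findTop (suc (length d)) d (c + c) (c + c) ≡ just (upsBefore d c + c)
  findTop-upsBefore c c< = findTop-just (isTop-unique c) (isTop-upsBefore c c<) (suc (length d)) (c + c)
    (+-monoˡ-≤ c (<⇒≤ (dyckFrom-upsBefore 0 d c dy c<)))
    (≤-trans (stepAt-just⇒< d _ (stepAt-upsBefore d c c<)) (≤-trans (n≤1+n _) (m≤n+m _ _)))

  bounceFrom-step : ∀ f c → c < ups d →
    let a = upsBefore d c in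
    bounceFrom (suc f) d (c + c) ≡ tent (a ∸ c) (bounceFrom f d (a + a))
  bounceFrom-step f c c<ups
    rewrite Equivalence.to T-≡ (<⇒<ᵇ (subst (c + c <_) (sym length≡ups+ups) (+-mono-< c<ups c<ups)))
          | findTop-upsBefore c (subst (c <_) (dyck-ups≡downs d dy) c<ups)
    = cong₂ (λ k x → tent k (bounceFrom f d x)) climb next
    where
    a : ℕ
    a = upsBefore d c
    c≤a : c ≤ a
    c≤a = <⇒≤ (dyckFrom-upsBefore 0 d c dy (subst (c <_) (dyck-ups≡downs d dy) c<ups))
    climb : a + c ∸ (c + c) ≡ a ∸ c
    climb = trans (cong (_∸ (c + c)) (+-comm a c)) ([m+n]∸[m+o]≡n∸o c a c)
    next : a + c + (a + c ∸ (c + c)) ≡ a + a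
    next = begin
      a + c + (a + c ∸ (c + c)) ≡⟨ cong (a + c +_) climb ⟩
      a + c + (a ∸ c)           ≡⟨ +-assoc a c (a ∸ c) ⟩
      a + (c + (a ∸ c))         ≡⟨ cong (a +_) (m+[n∸m]≡n c≤a) ⟩
      a + a                     ∎
      where open ≡-Reasoning

  bounceFrom-end : ∀ f → bounceFrom f d (ups d + ups d) ≡ []
  bounceFrom-end zero = refl
  bounceFrom-end (suc f) rewrite sym length≡ups+ups | <ᵇ-irrefl (length d) = refl

  bounceFrom-fuel : ∀ f₁ f₂ c → c ≤ ups d → ups d ∸ c ≤ f₁ → ups d ∸ c ≤ f₂ →
                    bounceFrom f₁ d (c + c) ≡ bounceFrom f₂ d (c + c)
  bounceFrom-fuel f₁ f₂ c c≤ f₁≥ f₂≥ with m≤n⇒m<n∨m≡n c≤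
  ... | inj₂ refl = trans (bounceFrom-end f₁) (sym (bounceFrom-end f₂))
  bounceFrom-fuel zero     f₂       c _ f₁≥ _   | inj₁ c< = ⊥-elim (<⇒≱ (m<n⇒0<n∸m c<) f₁≥)
  bounceFrom-fuel (suc f₁) zero     c _ _   f₂≥ | inj₁ c< = ⊥-elim (<⇒≱ (m<n⇒0<n∸m c<) f₂≥)
  bounceFrom-fuel (suc f₁) (suc f₂) c c≤ f₁≥ f₂≥ | inj₁ c<
    rewrite bounceFrom-step f₁ c c< | bounceFrom-step f₂ c c< =
    cong (tent (a ∸ c)) (bounceFrom-fuel f₁ f₂ a (upsBefore≤ups d c) (shrink f₁≥) (shrink f₂≥))
    where
    a : ℕ
    a = upsBefore d c
    c<a : c < a
    c<a = dyckFrom-upsBefore 0 d c dy (subst (c <_) (dyck-ups≡downs d dy) c<)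
    shrink : ∀ {f} → ups d ∸ c ≤ suc f → ups d ∸ a ≤ f
    shrink le = ≤-pred (≤-trans (∸-monoʳ-< c<a (upsBefore≤ups d c)) le)

-- When w contains exactly h down steps, the first bounce of unpeel h w rest has
-- height 1 + h, and peel w rest deletes its first 1 + h up and down steps.
unpeel : ℕ → List Bool → List Bool → List Bool
unpeel h w rest = replicate (suc h) true ++ false ∷ w ++ rest

peel : List Bool → List Bool → List Bool
peel w rest = replicate (ups w) true ++ rest

module Unpeel {h} (w rest : List Bool) (downs-w : downs w ≡ h) (dy : Dyck (unpeel h w rest)) where

  d d′ : List Bool
  d  = unpeel h w rest
  d′ = peel w rest

  dy′ : Dyck d′
  dy′ = subst T (sym (dyckFrom-replicate (ups w) 0 rest))
          (subst (λ m → T (dyckFrom m rest)) height≡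
            (dyckFrom-++ (h + 0) w rest (subst T (dyckFrom-replicate (suc h) 0 (false ∷ w ++ rest)) dy)))
    where
    height≡ : h + 0 + ups w ∸ downs w ≡ ups w + 0
    height≡ rewrite downs-w | +-identityʳ h | +-identityʳ (ups w) = m+n∸m≡n h (ups w)

  ups-d : ups d ≡ suc h + ups d′
  ups-d = begin
    ups d                     ≡⟨ ups-replicate (suc h) (false ∷ w ++ rest) ⟩
    suc h + ups (w ++ rest)   ≡⟨ cong (suc h +_) (ups-++ w rest) ⟩
    suc h + (ups w + ups rest) ≡⟨ cong (suc h +_) (sym (ups-replicate (ups w) rest)) ⟩
    suc h + ups d′            ∎
    where open ≡-Reasoning

  upsBefore-d : ∀ c → upsBefore d (suc h + c) ≡ suc h + upsBefore d′ c
  upsBefore-d c = begin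
    upsBefore d (suc h + c)
      ≡⟨ upsBefore-replicate (suc h) (false ∷ w ++ rest) (suc h + c) ⟩
    suc h + upsBefore (w ++ rest) (h + c)
      ≡⟨ cong (λ k → suc h + upsBefore (w ++ rest) (k + c)) (sym downs-w) ⟩
    suc h + upsBefore (w ++ rest) (downs w + c)
      ≡⟨ cong (suc h +_) (upsBefore-++ w rest c) ⟩
    suc h + (ups w + upsBefore rest c)
      ≡⟨ cong (suc h +_) (sym (upsBefore-replicate (ups w) rest c)) ⟩
    suc h + upsBefore d′ c
      ∎
    where open ≡-Reasoning

  bounceFrom-shift : ∀ f c → c ≤ ups d′ →
                     bounceFrom f d ((suc h + c) + (suc h + c)) ≡ bounceFrom f d′ (c + c)
  bounceFrom-shift zero    c c≤ = refl
  bounceFrom-shift (suc f) c c≤ with m≤n⇒m<n∨m≡n c≤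
  ... | inj₂ refl =
    trans (subst (λ m → bounceFrom (suc f) d (m + m) ≡ []) ups-d (Bounce.bounceFrom-end d dy (suc f)))
          (sym (Bounce.bounceFrom-end d′ dy′ (suc f)))
  ... | inj₁ c< = begin
    bounceFrom (suc f) d (H + H)
      ≡⟨ Bounce.bounceFrom-step d dy f H (subst (H <_) (sym ups-d) (+-monoʳ-< (suc h) c<)) ⟩
    tent (upsBefore d H ∸ H) (bounceFrom f d (upsBefore d H + upsBefore d H))
      ≡⟨ cong (λ A → tent (A ∸ H) (bounceFrom f d (A + A))) (upsBefore-d c) ⟩
    tent ((suc h + a) ∸ H) (bounceFrom f d ((suc h + a) + (suc h + a)))
      ≡⟨ cong₂ tent ([m+n]∸[m+o]≡n∸o (suc h) a c) (bounceFrom-shift f a (upsBefore≤ups d′ c)) ⟩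
    tent (a ∸ c) (bounceFrom f d′ (a + a))
      ≡⟨ sym (Bounce.bounceFrom-step d′ dy′ f c c<) ⟩
    bounceFrom (suc f) d′ (c + c) ∎
    where
    open ≡-Reasoning
    H : ℕ
    H = suc h + c
    a : ℕ
    a = upsBefore d′ c

  bpk-unpeel : bpk d ≡ suc (bpk d′)
  bpk-unpeel = begin
    peaks (bounceFrom (suc L) d 0)
      ≡⟨ cong peaks (Bounce.bounceFrom-step d dy L 0 (subst (0 <_) (sym ups-d) (s≤s z≤n))) ⟩
    peaks (tent (a ∸ 0) (bounceFrom L d (a + a)))
      ≡⟨ cong (λ k → peaks (tent k (bounceFrom L d (k + k)))) a≡ ⟩
    peaks (tent (suc h + 0) (bounceFrom L d ((suc h + 0) + (suc h + 0))))
      ≡⟨ peaks-tent (h + 0) _ ⟩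
    suc (peaks (bounceFrom L d ((suc h + 0) + (suc h + 0))))
      ≡⟨ cong (suc ∘ peaks) (bounceFrom-shift L 0 z≤n) ⟩
    suc (peaks (bounceFrom L d′ 0))
      ≡⟨ cong (suc ∘ peaks)
              (Bounce.bounceFrom-fuel d′ dy′ L (length d′) 0 z≤n ups≤L (ups≤length d′)) ⟩
    suc (bpk d′) ∎
    where
    open ≡-Reasoning
    L : ℕ
    L = length (replicate h true ++ false ∷ w ++ rest)
    a : ℕ
    a = upsBefore d 0
    a≡ : a ≡ suc h + 0
    a≡ = upsBefore-replicate (suc h) (false ∷ w ++ rest) 0
    ups≤L : ups d′ ≤ L
    ups≤L = ≤-trans (m≤n+m (ups d′) h) (≤-pred (subst (_≤ suc L) ups-d (ups≤length d)))

firstAscent : List Bool → ℕ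
firstAscent (true ∷ w) = suc (firstAscent w)
firstAscent _          = 0

firstAscent-unpeel : ∀ h w rest → firstAscent (unpeel h w rest) ≡ suc h
firstAscent-unpeel zero    w rest = refl
firstAscent-unpeel (suc h) w rest = cong suc (firstAscent-unpeel h w rest)

firstAscent-peel : ∀ w {rest} → firstAscent rest ≡ 0 → firstAscent (peel w rest) ≡ ups w
firstAscent-peel w {rest} no-ascent = go (ups w)
  where
  go : ∀ k → firstAscent (replicate k true ++ rest) ≡ k
  go zero    = no-ascent
  go (suc k) = cong suc (go k)

ascent-nonempty : ∀ m r → Dyck (replicate m true ++ false ∷ r) → 0 < m
ascent-nonempty (suc m) r _ = s≤s z≤n

-- Taking w maximal (rest does not start with an up step) makes the up steps of
-- w exactly the first ascent of peel w rest.
data Bounces : List Bool → Set where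
  []        : Bounces []
  peelFirst : ∀ {h w rest} → downs w ≡ h → firstAscent rest ≡ 0 → Dyck (unpeel h w rest) →
              Bounces (peel w rest) → Bounces (unpeel h w rest)

dyckFrom-suc⇒peak : ∀ k d → T (dyckFrom (suc k) d) → ∃₂ λ h r → d ≡ replicate h true ++ false ∷ r
dyckFrom-suc⇒peak k (false ∷ r) _  = 0 , r , refl
dyckFrom-suc⇒peak k (true ∷ d)  dy with dyckFrom-suc⇒peak (suc k) d dy
... | h , r , refl = suc h , r , refl

splitAfterDowns : ∀ k r → k ≤ downs r →
                  ∃₂ λ w rest → r ≡ w ++ rest × downs w ≡ k × firstAscent rest ≡ 0
splitAfterDowns k (true ∷ r) k≤ with splitAfterDowns k r k≤
... | w , rest , refl , downs-w , no-ascent = true ∷ w , rest , refl , downs-w , no-ascent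
splitAfterDowns zero    []          _        = [] , [] , refl , refl , refl
splitAfterDowns zero    (false ∷ r) _        = [] , false ∷ r , refl , refl , refl
splitAfterDowns (suc k) (false ∷ r) (s≤s k≤) with splitAfterDowns k r k≤
... | w , rest , refl , downs-w , no-ascent = false ∷ w , rest , refl , cong suc downs-w , no-ascent

length-peel<unpeel : ∀ h w rest → length (peel w rest) < length (unpeel h w rest)
length-peel<unpeel h w rest = begin-strict
  length (replicate (ups w) true ++ rest)        ≡⟨ length-++ (replicate (ups w) true) ⟩
  length (replicate (ups w) true) + length rest  ≡⟨ cong (_+ length rest) (length-replicate (ups w)) ⟩
  ups w + length rest                            ≤⟨ +-monoˡ-≤ (length rest) (ups≤length w) ⟩
  length w + length rest                         ≡⟨ sym (length-++ w) ⟩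
  length (w ++ rest)                             <⟨ n<1+n _ ⟩
  length (false ∷ w ++ rest)                     ≤⟨ m≤n+m _ (length (replicate h true)) ⟩
  length (replicate h true) + length (false ∷ w ++ rest) ≡⟨ sym (length-++ (replicate h true)) ⟩
  length (replicate h true ++ false ∷ w ++ rest) <⟨ n<1+n _ ⟩
  length (unpeel h w rest)                       ∎
  where open ≤-Reasoning

bounces-acc : ∀ d → Acc _<_ (length d) → Dyck d → Bounces d
bounces-acc []          _        _  = []
bounces-acc (true ∷ d₀) (acc rs) dy with dyckFrom-suc⇒peak 0 d₀ dy
... | h , r , refl with splitAfterDowns h r h≤downs
  where
  h≤downs : h ≤ downs r
  h≤downs = subst (h ≤_) (dyckFrom-balanced h r r-dyck) (m≤m+n h (ups r))
    where
    r-dyck : T (dyckFrom h r)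
    r-dyck = subst (λ m → T (dyckFrom m r)) (+-identityʳ h)
                   (subst T (dyckFrom-replicate (suc h) 0 (false ∷ r)) dy)
...   | w , rest , refl , downs-w , no-ascent =
  peelFirst downs-w no-ascent dy
    (bounces-acc (peel w rest) (rs (length-peel<unpeel h w rest)) (Unpeel.dy′ w rest downs-w dy))

bounces : ∀ d → Dyck d → Bounces d
bounces d = bounces-acc d (<-wellFounded (length d))

-- Every labelling has at least bpk d weak ascents

indexWord-unpeel : ∀ s h w rest → indexWord s s (unpeel h w rest)
                                   ≡ s ∷ range (suc s) h ++ s ∷ indexWord (s + suc h) (suc s) (w ++ rest)
indexWord-unpeel s h w rest = indexWord-replicate s s (suc h) (false ∷ w ++ rest)

indexWord-peel-⊆ : ∀ u v w rest → indexWord u (v + downs w) (peel w rest) ⊆ indexWord u v (w ++ rest)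
indexWord-peel-⊆ u v w rest
  rewrite indexWord-replicate u (v + downs w) (ups w) rest | indexWord-++ u v w rest =
  ++⁺ (upIndices⊆indexWord u v w) ⊆-refl

bpk≤weakAscents : ∀ {d} → Bounces d → ∀ (g : ℕ → ℕ) s → bpk d ≤ weakAscents (map g (indexWord s s d))
bpk≤weakAscents []                                         g s = z≤n
bpk≤weakAscents (peelFirst {h} {w} {rest} downs-w _ dy bs) g s = begin
  bpk (unpeel h w rest)                  ≡⟨ Unpeel.bpk-unpeel w rest downs-w dy ⟩
  suc (bpk (peel w rest))                ≤⟨ s≤s (bpk≤weakAscents bs g H) ⟩
  suc (weakAscents (map g inner))        ≤⟨ s≤s (weakAscents≤weakAscentsFrom (g s) (map g inner)) ⟩
  suc (weakAscentsFrom (g s) (map g inner)) ≤⟨ s≤s (weakAscentsFrom-mono-⊆ (g s) (map⁺ g deleteDowns)) ⟩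
  suc (weakAscentsFrom (g s) (map g after)) ≤⟨ weakAscentsFrom-return (map g (range (suc s) h)) _ ≤-refl ⟩
  weakAscentsFrom (g s) (map g (range (suc s) h) ++ g s ∷ map g after)
    ≡⟨ cong (weakAscentsFrom (g s)) (sym (map-++ g (range (suc s) h) (s ∷ after))) ⟩
  weakAscents (map g (s ∷ range (suc s) h ++ s ∷ after))
    ≡⟨ cong (weakAscents ∘ map g) (sym (indexWord-unpeel s h w rest)) ⟩
  weakAscents (map g (indexWord s s (unpeel h w rest)))
    ∎
  where
  open ≤-Reasoning
  H : ℕ
  H = s + suc h
  inner after : List ℕ
  inner = indexWord H H (peel w rest)
  after = indexWord H (suc s) (w ++ rest)
  deleteDowns : inner ⊆ after
  deleteDowns = subst (λ v → indexWord H v (peel w rest) ⊆ after)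
                      (trans (cong (suc s +_) downs-w) (sym (+-suc s h)))
                      (indexWord-peel-⊆ H (suc s) w rest)

-- A labelling with at most bpk d weak ascents

*-suc-gap : ∀ M {a b} → a < b → M * suc a + M ≤ M * suc b
*-suc-gap M {a} {b} a<b = begin
  M * suc a + M     ≡⟨ +-comm (M * suc a) M ⟩
  M + M * suc a     ≡⟨ sym (*-suc M (suc a)) ⟩
  M * suc (suc a)   ≤⟨ *-monoʳ-≤ M (s≤s a<b) ⟩
  M * suc b         ∎
  where open ≤-Reasoning

-- Labels for unpeel h w rest built from labels f′ for peel w rest, whose steps
-- carry the indices from H on and whose first ascent carries H, ..., C - 1.
-- The labels f′ are spread out by the factor M; a down step k < H of the first
-- bounce is slotted just above the up step u that follows it, or below every
-- other label if u lies beyond the first ascent of peel w rest.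
module Extend (s h : ℕ) (w : List Bool) (downs-w : downs w ≡ h) (f′ : ℕ → ℕ)
              (f′-desc : DescendingOn f′ (s + suc h) (ups w)) where

  H C M : ℕ
  H = s + suc h
  C = H + ups w
  M = suc (suc h)

  upLabel : ℕ → ℕ
  upLabel u = M * suc (f′ u)

  downLabel : ℕ → ℕ → ℕ
  downLabel u k = if u <ᵇ C then upLabel u + (H ∸ k) else H ∸ suc k

  f : ℕ → ℕ
  f k = if k <ᵇ H then downLabel (H + upsBefore (false ∷ w) (k ∸ s)) k else upLabel k

  offset< : ∀ {k} → s ≤ k → H ∸ k < M
  offset< s≤k = s≤s (≤-trans (∸-monoʳ-≤ H s≤k) (≤-reflexive (m+n∸m≡n s (suc h))))

  M≤upLabel : ∀ u → M ≤ upLabel u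
  M≤upLabel u = m≤m*n M (suc (f′ u))

  f′-step : ∀ {u} → H ≤ u → suc u < C → f′ (suc u) < f′ u
  f′-step = descendingOn⇒step f′ f′-desc

  downLabel-< : ∀ {u} k → u < C → downLabel u k ≡ upLabel u + (H ∸ k)
  downLabel-< k = if-<ᵇ-<

  downLabel-≥ : ∀ {u} k → C ≤ u → downLabel u k ≡ H ∸ suc k
  downLabel-≥ k = if-<ᵇ-≥

  f-≥ : ∀ {k} → H ≤ k → f k ≡ upLabel k
  f-≥ = if-<ᵇ-≥

  f-< : ∀ {k} → k < H → f k ≡ downLabel (H + upsBefore (false ∷ w) (k ∸ s)) k
  f-< = if-<ᵇ-<

  upLabel-step : ∀ {u} → H ≤ u → suc u < C → upLabel (suc u) < upLabel u
  upLabel-step H≤u su<C = ≤-trans (m<m+n _ (s≤s z≤n)) (*-suc-gap M (f′-step H≤u su<C))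

  upLabel<downLabel : ∀ {u k} → u < C → k < H → upLabel u < downLabel u k
  upLabel<downLabel {u} {k} u<C k<H rewrite downLabel-< k u<C =
    m<m+n (upLabel u) (m<n⇒0<n∸m k<H)

  downLabel-step : ∀ u {k} → suc k < H → downLabel u (suc k) < downLabel u k
  downLabel-step u {k} sk<H with u <? C
  ... | yes u<C rewrite downLabel-< (suc k) u<C | downLabel-< k u<C =
    +-monoʳ-< (upLabel u) (∸-monoʳ-< (n<1+n k) (<⇒≤ sk<H))
  ... | no u≮C rewrite downLabel-≥ (suc k) (≮⇒≥ u≮C) | downLabel-≥ k (≮⇒≥ u≮C) =
    ∸-monoʳ-< (n<1+n (suc k)) sk<H

  downLabel<upLabel : ∀ {u k} → H ≤ u → s ≤ k → u < C → downLabel (suc u) k < upLabel u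
  downLabel<upLabel {u} {k} H≤u s≤k u<C with suc u <? C
  ... | yes su<C rewrite downLabel-< k su<C = begin-strict
    upLabel (suc u) + (H ∸ k) <⟨ +-monoʳ-< (upLabel (suc u)) (offset< s≤k) ⟩
    upLabel (suc u) + M       ≤⟨ *-suc-gap M (f′-step H≤u su<C) ⟩
    upLabel u                 ∎
    where open ≤-Reasoning
  ... | no su≮C rewrite downLabel-≥ k (≮⇒≥ su≮C) =
    ≤-trans (s≤s (∸-monoʳ-≤ H (n≤1+n k))) (≤-trans (offset< s≤k) (M≤upLabel u))

  -- Invariant of a left-to-right reading: α is the last label read, the next
  -- up and down steps carry the indices u and v, and the down steps still to
  -- come are labelled according to the up steps preceding them.
  descending-walk : ∀ w₀ {u v α} →
                    H ≤ u → u + ups w₀ ≤ C → v + downs w₀ ≤ H → s ≤ v →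
                    (u < C → upLabel u < α) → (v < H → downLabel u v < α) →
                    (∀ j → v + j < H → f (v + j) ≡ downLabel (u + upsBefore w₀ j) (v + j)) →
                    Linked _>_ (α ∷ map f (indexWord u v w₀))
  descending-walk [] _ _ _ _ _ _ _ = [-]
  descending-walk (true ∷ w₀) {u} {v} H≤u u-room v-room s≤v up< down< labels
    rewrite f-≥ H≤u =
    up< u<C ∷ descending-walk w₀ (m≤n⇒m≤1+n H≤u) (subst (_≤ C) (+-suc u (ups w₀)) u-room) v-room s≤v
                (upLabel-step H≤u) (λ _ → downLabel<upLabel H≤u s≤v u<C)
                (λ j v+j<H → trans (labels j v+j<H)
                                   (cong (λ x → downLabel x (v + j)) (+-suc u (upsBefore w₀ j))))
    where
    u<C : u < C
    u<C = ≤-trans (s≤s (m≤m+n u (ups w₀))) (subst (_≤ C) (+-suc u (ups w₀)) u-room)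
  descending-walk (false ∷ w₀) {u} {v} {α} H≤u u-room v-room s≤v up< down< labels =
    subst (λ x → Linked _>_ (α ∷ x ∷ map f (indexWord u (suc v) w₀))) (sym fv)
      (down< v<H ∷ descending-walk w₀ H≤u u-room (subst (_≤ H) (+-suc v (downs w₀)) v-room)
                     (m≤n⇒m≤1+n s≤v)
                     (λ u<C → upLabel<downLabel u<C v<H) (λ sv<H → downLabel-step u sv<H)
                     (λ j sv+j<H → subst (λ x → f x ≡ downLabel (u + upsBefore w₀ j) x) (+-suc v j)
                                         (labels (suc j) (subst (_< H) (sym (+-suc v j)) sv+j<H))))
    where
    v<H : v < H
    v<H = ≤-trans (s≤s (m≤m+n v (downs w₀))) (subst (_≤ H) (+-suc v (downs w₀)) v-room)
    fv : f v ≡ downLabel u v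
    fv = subst₂ (λ x y → f x ≡ downLabel y x) (+-identityʳ v) (+-identityʳ u)
                (labels 0 (subst (_< H) (sym (+-identityʳ v)) v<H))

  f-s : f s ≡ downLabel H s
  f-s = begin
    f s
      ≡⟨ f-< (m<m+n s (s≤s z≤n)) ⟩
    downLabel (H + upsBefore (false ∷ w) (s ∸ s)) s
      ≡⟨ cong (λ j → downLabel (H + upsBefore (false ∷ w) j) s) (n∸n≡0 s) ⟩
    downLabel (H + 0) s
      ≡⟨ cong (λ x → downLabel x s) (+-identityʳ H) ⟩
    downLabel H s
      ∎
    where open ≡-Reasoning

  reading-from-first-down : Linked _>_ (f s ∷ map f (indexWord H (suc s) w))
  reading-from-first-down = Linked.tail (descending-walk (false ∷ w) ≤-refl ≤-refl
    (≤-reflexive (cong (λ k → s + suc k) downs-w)) ≤-refl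
    (λ H<C → subst (upLabel H <_) (cong suc (sym f-s)) (m<n⇒m<1+n (upLabel<downLabel H<C s<H)))
    (λ _ → subst (downLabel H s <_) (cong suc (sym f-s)) (n<1+n _))
    (λ j s+j<H → trans (f-< s+j<H)
                       (cong (λ i → downLabel (H + upsBefore (false ∷ w) i) (s + j)) (m+n∸m≡n s j))))
    where
    s<H : s < H
    s<H = m<m+n s (s≤s z≤n)

  first-ascent-descending : DescendingOn f s (suc h)
  first-ascent-descending = linked-⊆ (λ y<x z<y → <-trans z<y y<x)
    (map⁺ f (subst (λ k → range (suc s) k ⊆ indexWord H (suc s) w) downs-w
                   (downIndices⊆indexWord H (suc s) w)))
    reading-from-first-down

  relabel : ∀ {xs} → All (H ≤_) xs → weakAscents (map f xs) ≤ weakAscents (map f′ xs)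
  relabel = weakAscents-map-≤ f′ f (λ H≤x H≤y f′y<f′x →
    subst₂ _<_ (sym (f-≥ H≤y)) (sym (f-≥ H≤x)) (*-monoʳ-< M (s≤s f′y<f′x)))

  reading-after-first-ascent : ∀ rest →
    weakAscents (map f (indexWord s s (unpeel h w rest)))
      ≤ suc (weakAscentsFrom (f s) (map f (indexWord H (suc s) w) ++ map f (indexWord C H rest)))
  reading-after-first-ascent rest = begin
    weakAscents (map f (indexWord s s (unpeel h w rest)))
      ≡⟨ cong (weakAscents ∘ map f) (indexWord-unpeel s h w rest) ⟩
    weakAscentsFrom (f s) (map f (range (suc s) h ++ s ∷ X))
      ≡⟨ cong (weakAscentsFrom (f s)) (map-++ f (range (suc s) h) (s ∷ X)) ⟩
    weakAscentsFrom (f s) (map f (range (suc s) h) ++ map f (s ∷ X))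
      ≤⟨ weakAscentsFrom-descending-++ (map f (s ∷ X)) first-ascent-descending ⟩
    suc (weakAscentsFrom (f s) (map f X))
      ≡⟨ cong (suc ∘ weakAscentsFrom (f s) ∘ map f) X≡ ⟩
    suc (weakAscentsFrom (f s) (map f (indexWord H (suc s) w ++ indexWord C H rest)))
      ≡⟨ cong (suc ∘ weakAscentsFrom (f s)) (map-++ f (indexWord H (suc s) w) (indexWord C H rest)) ⟩
    suc (weakAscentsFrom (f s) (map f (indexWord H (suc s) w) ++ map f (indexWord C H rest))) ∎
    where
    open ≤-Reasoning
    X : List ℕ
    X = indexWord H (suc s) (w ++ rest)
    X≡ : X ≡ indexWord H (suc s) w ++ indexWord C H rest
    X≡ = trans (indexWord-++ H (suc s) w rest)
               (cong (λ v → indexWord H (suc s) w ++ indexWord C v rest)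
                     (trans (cong (suc s +_) downs-w) (sym (+-suc s h))))

  weakAscents-unpeel : ∀ {rest} → firstAscent rest ≡ 0 → Dyck (peel w rest) →
    weakAscents (map f (indexWord s s (unpeel h w rest)))
      ≤ suc (weakAscents (map f′ (indexWord H H (peel w rest))))
  weakAscents-unpeel {[]} _ _ =
    ≤-trans (reading-after-first-ascent []) (s≤s (≤-trans (≤-reflexive reading≡0) z≤n))
    where
    reading≡0 : weakAscentsFrom (f s) (map f (indexWord H (suc s) w) ++ []) ≡ 0
    reading≡0 = trans (cong (weakAscentsFrom (f s)) (++-identityʳ (map f (indexWord H (suc s) w))))
                      (weakAscentsFrom-descending reading-from-first-down)
  weakAscents-unpeel {false ∷ r′} _ dy′ = begin
    weakAscents (map f (indexWord s s (unpeel h w (false ∷ r′))))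
      ≤⟨ reading-after-first-ascent (false ∷ r′) ⟩
    suc (weakAscentsFrom (f s) (map f (indexWord H (suc s) w) ++ f H ∷ map f R))
      ≤⟨ s≤s (weakAscentsFrom-descending-++ (f H ∷ map f R) reading-from-first-down) ⟩
    suc (suc (weakAscentsFrom (f H) (map f R)))
      ≤⟨ s≤s (weakAscents-range-return f H (ups w) R (ascent-nonempty (ups w) r′ dy′)) ⟩
    suc (weakAscents (map f (range H (ups w) ++ H ∷ R)))
      ≡⟨ cong (suc ∘ weakAscents ∘ map f) (sym (indexWord-replicate H H (ups w) (false ∷ r′))) ⟩
    suc (weakAscents (map f (indexWord H H (peel w (false ∷ r′)))))
      ≤⟨ s≤s (relabel (indexWord-≥ (peel w (false ∷ r′)) ≤-refl ≤-refl)) ⟩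
    suc (weakAscents (map f′ (indexWord H H (peel w (false ∷ r′))))) ∎
    where
    open ≤-Reasoning
    R : List ℕ
    R = indexWord C (suc H) r′

weakAscents≤bpk : ∀ {d} → Bounces d → ∀ s → ∃ λ (f : ℕ → ℕ) →
                  DescendingOn f s (firstAscent d) × weakAscents (map f (indexWord s s d)) ≤ bpk d
weakAscents≤bpk [] s = (λ _ → 0) , [] , z≤n
weakAscents≤bpk (peelFirst {h} {w} {rest} downs-w no-ascent dy bs) s with weakAscents≤bpk bs (s + suc h)
... | f′ , f′-desc , f′-bound =
  f , subst (DescendingOn f s) (sym (firstAscent-unpeel h w rest)) first-ascent-descending , bound
  where
  open Extend s h w downs-w f′ (subst (DescendingOn f′ (s + suc h)) (firstAscent-peel w no-ascent) f′-desc)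
  bound : weakAscents (map f (indexWord s s (unpeel h w rest))) ≤ bpk (unpeel h w rest)
  bound = begin
    weakAscents (map f (indexWord s s (unpeel h w rest)))
      ≤⟨ weakAscents-unpeel no-ascent (Unpeel.dy′ w rest downs-w dy) ⟩
    suc (weakAscents (map f′ (indexWord H H (peel w rest))))
      ≤⟨ s≤s f′-bound ⟩
    suc (bpk (peel w rest))
      ≡⟨ sym (Unpeel.bpk-unpeel w rest downs-w dy) ⟩
    bpk (unpeel h w rest)
      ∎
    where open ≤-Reasoning

-- From labellings to permutations

injective⇒surjective : ∀ {n} (g : Fin n → Fin n) → Injective _≡_ _≡_ g → ∀ y → ∃ λ x → g x ≡ y
injective⇒surjective {suc n} g g-inj y with any? (λ x → g x Fin.≟ y)
... | yes hit = hit
... | no miss = ⊥-elim (1+n≰n (injective⇒≤ {f = squeeze} squeeze-inj))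
  where
  avoids : ∀ x → y ≢ g x
  avoids x y≡gx = miss (x , sym y≡gx)
  squeeze : Fin (suc n) → Fin n
  squeeze x = punchOut (avoids x)
  squeeze-inj : Injective _≡_ _≡_ squeeze
  squeeze-inj {a} {b} eq = g-inj (punchOut-injective (avoids a) (avoids b) eq)

-- On [0, n), σ is ordered like f, with ties broken by position.
module Ranking (n : ℕ) (f : ℕ → ℕ) where

  key : ℕ → ℕ
  key k = f k * n + k

  key-<ᶠ : ∀ {j k} → j < n → f j < f k → key j < key k
  key-<ᶠ {j} {k} j<n fj<fk = begin-strict
    f j * n + j    <⟨ +-monoʳ-< (f j * n) j<n ⟩
    f j * n + n    ≡⟨ +-comm (f j * n) n ⟩
    suc (f j) * n  ≤⟨ *-monoˡ-≤ n fj<fk ⟩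
    f k * n        ≤⟨ m≤m+n (f k * n) k ⟩
    key k          ∎
    where open ≤-Reasoning

  key-injective : ∀ {j k} → j < n → k < n → key j ≡ key k → j ≡ k
  key-injective {j} {k} j<n k<n eq with <-cmp (f j) (f k)
  ... | tri< fj<fk _ _ = ⊥-elim (<-irrefl eq (key-<ᶠ j<n fj<fk))
  ... | tri> _ _ fk<fj = ⊥-elim (<-irrefl (sym eq) (key-<ᶠ k<n fk<fj))
  ... | tri≈ _ fj≡fk _ = +-cancelˡ-≡ (f k * n) j k (subst (λ x → x * n + j ≡ key k) fj≡fk eq)

  indicator : ℕ → ℕ → ℕ
  indicator i k = if key i <ᵇ key k then 1 else 0

  indicator≤1 : ∀ i k → indicator i k ≤ 1
  indicator≤1 i k with key i <ᵇ key k
  ... | true  = ≤-refl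
  ... | false = z≤n

  indicator-mono : ∀ i {j k} → key j < key k → indicator i j ≤ indicator i k
  indicator-mono i {j} {k} kj<kk with key i <ᵇ key j | <ᵇ-reflects-< (key i) (key j)
  ... | false | _         = z≤n
  ... | true  | ofʸ ki<kj rewrite if-<ᵇ-< {x = 1} {0} (<-trans ki<kj kj<kk) = ≤-refl

  countBelow : ℕ → ℕ → ℕ
  countBelow zero    k = 0
  countBelow (suc m) k = indicator m k + countBelow m k

  countBelow≤ : ∀ m k → countBelow m k ≤ m
  countBelow≤ zero    k = z≤n
  countBelow≤ (suc m) k = +-mono-≤ (indicator≤1 m k) (countBelow≤ m k)

  countBelow-mono : ∀ m {j k} → key j < key k → countBelow m j ≤ countBelow m k
  countBelow-mono zero    kj<kk = z≤n
  countBelow-mono (suc m) kj<kk = +-mono-≤ (indicator-mono m kj<kk) (countBelow-mono m kj<kk)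

  countBelow< : ∀ m k → k < m → countBelow m k < m
  countBelow< (suc m) k (s≤s k≤m) with m≤n⇒m<n∨m≡n k≤m
  ... | inj₂ refl rewrite if-<ᵇ-≥ {x = 1} {0} (≤-refl {key k}) = s≤s (countBelow≤ k k)
  ... | inj₁ k<m  = s≤s (≤-trans (+-monoˡ-≤ (countBelow m k) (indicator≤1 m k)) (countBelow< m k k<m))

  countBelow-strict : ∀ m {j k} → key j < key k → j < m → countBelow m j < countBelow m k
  countBelow-strict (suc m) {j} {k} kj<kk (s≤s j≤m) with m≤n⇒m<n∨m≡n j≤m
  ... | inj₂ refl rewrite if-<ᵇ-≥ {x = 1} {0} (≤-refl {key j}) | if-<ᵇ-< {x = 1} {0} kj<kk =
    s≤s (countBelow-mono j kj<kk)
  ... | inj₁ j<m = +-mono-≤-< (indicator-mono m kj<kk) (countBelow-strict m kj<kk j<m)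

  rank : Fin n → Fin n
  rank i = fromℕ< (countBelow< n (toℕ i) (toℕ<n i))

  toℕ-rank : ∀ i → toℕ (rank i) ≡ countBelow n (toℕ i)
  toℕ-rank i = toℕ-fromℕ< (countBelow< n (toℕ i) (toℕ<n i))

  rank-injective : Injective _≡_ _≡_ rank
  rank-injective {a} {b} eq with <-cmp (key (toℕ a)) (key (toℕ b))
  ... | tri< ka<kb _ _ = ⊥-elim (<-irrefl same (countBelow-strict n ka<kb (toℕ<n a)))
    where same = trans (sym (toℕ-rank a)) (trans (cong toℕ eq) (toℕ-rank b))
  ... | tri> _ _ kb<ka = ⊥-elim (<-irrefl same (countBelow-strict n kb<ka (toℕ<n b)))
    where same = trans (sym (toℕ-rank b)) (trans (cong toℕ (sym eq)) (toℕ-rank a))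
  ... | tri≈ _ ka≡kb _ = toℕ-injective (key-injective (toℕ<n a) (toℕ<n b) ka≡kb)

  σ : Permutation′ n
  σ = permutation rank rank⁻¹ (proj₂ ∘ onto) (λ x → rank-injective (proj₂ (onto (rank x))))
    where
    onto : ∀ y → ∃ λ x → rank x ≡ y
    onto = injective⇒surjective rank rank-injective
    rank⁻¹ : Fin n → Fin n
    rank⁻¹ = proj₁ ∘ onto

  label-σ : ∀ {k} → k < n → label σ k ≡ countBelow n k
  label-σ {k} k<n with k <? n
  ... | yes p  = trans (toℕ-rank (fromℕ< p)) (cong (countBelow n) (toℕ-fromℕ< p))
  ... | no k≮n = ⊥-elim (k≮n k<n)

  label-σ-keeps-descents : ∀ {x y} → x < n → y < n → f y < f x → label σ y < label σ x
  label-σ-keeps-descents x<n y<n fy<fx =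
    subst₂ _<_ (sym (label-σ y<n)) (sym (label-σ x<n)) (countBelow-strict n (key-<ᶠ y<n fy<fx) y<n)

des≡2n∸1∸weakAscents : ∀ {n} d → length d ≡ 2 * n → ∀ (σ : Permutation′ n) →
                       des d σ ≡ 2 * n ∸ 1 ∸ weakAscents (map (label σ) (indexWord 0 0 d))
des≡2n∸1∸weakAscents {n} d length≡2n σ = begin
  descents (canFrom σ 0 0 d)  ≡⟨ cong descents (canFrom≡map-label σ 0 0 d) ⟩
  descents labels             ≡⟨ descents≡length∸1∸weakAscents labels ⟩
  length labels ∸ 1 ∸ N       ≡⟨ cong (λ L → L ∸ 1 ∸ N) length≡ ⟩
  2 * n ∸ 1 ∸ N               ∎
  where
  open ≡-Reasoning
  labels : List ℕ
  labels = map (label σ) (indexWord 0 0 d)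
  N : ℕ
  N = weakAscents labels
  length≡ : length labels ≡ 2 * n
  length≡ = trans (length-map (label σ) (indexWord 0 0 d)) (trans (length-indexWord 0 0 d) length≡2n)

isDyck⇒indices< : ∀ {n} d → IsDyck n d → All (_< n) (indexWord 0 0 d)
isDyck⇒indices< {n} d (length≡2n , dy) =
  indexWord-< d (≤-reflexive ups≡n) (≤-reflexive (trans (sym (dyck-ups≡downs d dy)) ups≡n))
  where
  ups≡n : ups d ≡ n
  ups≡n = double-injective
    (trans (sym (Bounce.length≡ups+ups d dy)) (trans length≡2n (cong (n +_) (+-identityʳ n))))

theorem3p9 : (n : ℕ) (d : List Bool) → IsDyck n d → DegC≡ n d (2 * n ∸ 1 ∸ bpk d)
theorem3p9 n d isDyck@(length≡2n , dy) = (σ , ≤-antisym (des≤ σ) des≥) , des≤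
  where
  bs : Bounces d
  bs = bounces d dy

  des≤ : ∀ σ → des d σ ≤ 2 * n ∸ 1 ∸ bpk d
  des≤ σ = subst (_≤ 2 * n ∸ 1 ∸ bpk d) (sym (des≡2n∸1∸weakAscents d length≡2n σ))
                 (∸-monoʳ-≤ (2 * n ∸ 1) (bpk≤weakAscents bs (label σ) 0))

  f : ℕ → ℕ
  f = proj₁ (weakAscents≤bpk bs 0)
  open Ranking n f using (σ; label-σ-keeps-descents)

  des≥ : 2 * n ∸ 1 ∸ bpk d ≤ des d σ
  des≥ = subst (2 * n ∸ 1 ∸ bpk d ≤_) (sym (des≡2n∸1∸weakAscents d length≡2n σ))
    (∸-monoʳ-≤ (2 * n ∸ 1)
      (≤-trans (weakAscents-map-≤ f (label σ) label-σ-keeps-descents (isDyck⇒indices< d isDyck))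
               (proj₂ (proj₂ (weakAscents≤bpk bs 0)))))
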